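{- Let $G$ and $H$ be graphs. Then $\chi_d(G\diamond H) = \beta(G) + \chi(H) + 1$, where $\beta(G)$ is the vertex cover number of $G$ and $\chi(H)$ is the chromatic number of $H$.
   Context: Graphs are finite and simple. A dominator coloring of a graph $X$ is a proper vertex coloring of $X$ such that every vertex $u$ either forms a color class by itself or is adjacent to all vertices of at least one color class; $\chi_d(X)$ is the minimum number of colors in a dominator coloring of $X$. The vertex cover number $\beta(G)$ is the minimum size of a set of vertices containing at least one endpoint of every edge. The edge corona $G\diamond H$ is obtained by taking one copy of $G$ and $m(G)$ (the number of edges of $G$) disjoint copies of $H$, assigned one-to-one to the edges of $G$, and for every edge $gg'$ of $G$ joining both $g$ and $g'$ to every vertex of the copy of $H$ assigned to $gg'$.
   Formalization: The graph G is assumed to have no isolated vertices, so every vertex of G is an endpoint of at least one edge of G. The statement above fails without it. -}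

module Defs where

open import Data.Nat using (ℕ; _≤_; _+_)
open import Data.Fin using (Fin; _<_; _≟_)
open import Data.Fin.Subset using (Subset; _∈_; ∣_∣)
open import Data.Bool using (Bool; true; false; _∧_; _∨_)
open import Data.Bool.Properties using (∧-comm; ∨-comm)
open import Data.Product using (Σ; Σ-syntax; _×_; _,_; proj₁; proj₂)
open import Data.Sum using (_⊎_; inj₁; inj₂)
open import Relation.Nullary using (¬_; yes; no)
open import Relation.Nullary.Decidable using (⌊_⌋)
open import Relation.Binary.PropositionalEquality using (_≡_; _≢_; refl; sym; cong₂)
open import Function.Definitions using (Surjective)

record Graph (V : Set) : Set where
  field
    adj    : V → V → Bool
    adjSym : ∀ u v → adj u v ≡ adj v u
    adjIrr : ∀ v → adj v v ≡ false

open Graph public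

Adjacent : {V : Set} → Graph V → V → V → Set
Adjacent G u v = adj G u v ≡ true

FinGraph : ℕ → Set
FinGraph n = Graph (Fin n)

-- Edges of a finite graph: each edge {i,j} is represented once, as (i , j)
-- with i < j.

Edge : {n : ℕ} → FinGraph n → Set
Edge {n} G = Σ[ p ∈ Fin n × Fin n ] (proj₁ p < proj₂ p × Adjacent G (proj₁ p) (proj₂ p))

_==_ : {n : ℕ} → Fin n → Fin n → Bool
i == j = ⌊ i ≟ j ⌋

==-sym : {n : ℕ} (i j : Fin n) → (i == j) ≡ (j == i)
==-sym i j with i ≟ j | j ≟ i
... | yes _ | yes _ = refl
... | no _  | no _  = refl
... | yes p | no q  = Data.Empty.⊥-elim (q (sym p)) where import Data.Empty
... | no p  | yes q = Data.Empty.⊥-elim (p (sym q)) where import Data.Empty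

endpoint : {n : ℕ} {G : FinGraph n} → Fin n → Edge G → Bool
endpoint u ((i , j) , _) = (u == i) ∨ (u == j)

sameEdge : {n : ℕ} {G : FinGraph n} → Edge G → Edge G → Bool
sameEdge ((i , j) , _) ((i' , j') , _) = (i == i') ∧ (j == j')

sameEdge-sym : {n : ℕ} {G : FinGraph n} (e e' : Edge G) → sameEdge {G = G} e e' ≡ sameEdge {G = G} e' e
sameEdge-sym ((i , j) , _) ((i' , j') , _) = cong₂ _∧_ (==-sym i i') (==-sym j j')

-- Edge corona G ⋄ H: one copy of G, and for every edge e of G a copy
-- {e} × Fin h of H; both endpoints of e are joined to every vertex of
-- the copy of H assigned to e.

CoronaV : {n : ℕ} → FinGraph n → ℕ → Set
CoronaV {n} G h = Fin n ⊎ (Edge G × Fin h)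

coronaAdj : {n h : ℕ} (G : FinGraph n) (H : FinGraph h) → CoronaV G h → CoronaV G h → Bool
coronaAdj G H (inj₁ u) (inj₁ v) = adj G u v
coronaAdj G H (inj₁ u) (inj₂ (e , x)) = endpoint {G = G} u e
coronaAdj G H (inj₂ (e , x)) (inj₁ u) = endpoint {G = G} u e
coronaAdj G H (inj₂ (e , x)) (inj₂ (e' , y)) = sameEdge {G = G} e e' ∧ adj H x y

coronaSym : {n h : ℕ} (G : FinGraph n) (H : FinGraph h) → ∀ u v → coronaAdj G H u v ≡ coronaAdj G H v u
coronaSym G H (inj₁ u) (inj₁ v) = adjSym G u v
coronaSym G H (inj₁ u) (inj₂ _) = refl
coronaSym G H (inj₂ _) (inj₁ u) = refl
coronaSym G H (inj₂ (e , x)) (inj₂ (e' , y)) = cong₂ _∧_ (sameEdge-sym {G = G} e e') (adjSym H x y)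

coronaIrr : {n h : ℕ} (G : FinGraph n) (H : FinGraph h) → ∀ v → coronaAdj G H v v ≡ false
coronaIrr G H (inj₁ u) = adjIrr G u
coronaIrr G H (inj₂ (e , x)) rewrite adjIrr H x = ∧-zeroʳ (sameEdge {G = G} e e)
  where open import Data.Bool.Properties using (∧-zeroʳ)

_⋄_ : {n h : ℕ} (G : FinGraph n) (H : FinGraph h) → Graph (CoronaV G h)
G ⋄ H = record { adj = coronaAdj G H ; adjSym = coronaSym G H ; adjIrr = coronaIrr G H }

Proper : {V : Set} (X : Graph V) {k : ℕ} → (V → Fin k) → Set
Proper {V} X c = ∀ (u v : V) → Adjacent X u v → c u ≢ c v

-- Dominator coloring with exactly k colors: proper, every one of the k
-- colors is used (so the k color classes are nonempty), and every vertex u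
-- either forms a color class by itself or is adjacent to every vertex of
-- some color class.
DominatorColoring : {V : Set} (X : Graph V) (k : ℕ) → (V → Fin k) → Set
DominatorColoring {V} X k c =
  Proper X c × Surjective _≡_ _≡_ c ×
  (∀ (u : V) → (∀ (v : V) → c v ≡ c u → v ≡ u)
             ⊎ Σ[ i ∈ Fin k ] (∀ (v : V) → c v ≡ i → Adjacent X u v))

IsDominatorChromaticNumber : {V : Set} → Graph V → ℕ → Set
IsDominatorChromaticNumber {V} X k =
  Σ[ c ∈ (V → Fin k) ] DominatorColoring X k c ×
  (∀ (k' : ℕ) (c' : V → Fin k') → DominatorColoring X k' c' → k ≤ k')

IsChromaticNumber : {V : Set} → Graph V → ℕ → Set
IsChromaticNumber {V} X k =
  Σ[ c ∈ (V → Fin k) ] Proper X c ×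
  (∀ (k' : ℕ) (c' : V → Fin k') → Proper X c' → k ≤ k')

VertexCover : {n : ℕ} → FinGraph n → Subset n → Set
VertexCover {n} G S = ∀ (u v : Fin n) → Adjacent G u v → u ∈ S ⊎ v ∈ S

IsVertexCoverNumber : {n : ℕ} → FinGraph n → ℕ → Set
IsVertexCoverNumber {n} G b =
  Σ[ S ∈ Subset n ] (VertexCover G S × ∣ S ∣ ≡ b) ×
  (∀ (S : Subset n) → VertexCover G S → b ≤ ∣ S ∣)

NoIsolatedVertices : {n : ℕ} → FinGraph n → Set
NoIsolatedVertices {n} G = ∀ (u : Fin n) → Σ[ v ∈ Fin n ] Adjacent G u v

-- Upper bound: give each vertex of a minimum vertex cover S its own color, color every copy of H
-- with one and the same χ(H) colors, and all of V(G) ∖ S with one more color. Every vertex outside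
-- S has a neighbor in S, whose color class is a singleton, so it dominates that class.
--
-- Lower bound: let c be a dominator coloring and fix an edge vw of G, with v chosen to share its
-- color whenever some vertex of G does. The copy of H on vw sees a set Q of at least χ(H) colors,
-- none of them c(v). Every color outside Q other than c(v) names a vertex of G, and the named
-- vertices T form a vertex cover: a vertex of G that is alone in its color class names itself, and
-- if both ends of an edge e share their colors, then a vertex of the copy of H on e cannot dominate
-- a class containing an end of e, so its own class or the class it dominates lies inside that copy
-- and names an end of e. Hence β(G) + χ(H) ≤ ∣T∣ + ∣Q∣ < χ_d(G ⋄ H).
module Submission where

open import Defs
open import Data.Nat using (ℕ; _+_; _≤_; _<_; zero; suc; s≤s; _∸_; _≤?_)
open import Data.Nat.Properties using (+-comm; +-mono-≤; +-monoˡ-≤; m∸n+n≡m; 1+n≰n; module ≤-Reasoning)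
open import Data.Fin using (Fin; zero; suc; _≟_; punchOut)
open import Data.Fin.Properties using (any?; suc-injective; <-cmp; injective⇒≤; punchOut-injective; ¬∀⟶∃¬; +↔⊎)
open import Data.Fin.Subset using (Subset; _∈_; _∉_; ∣_∣; ∁; ⁅_⁆; ⊤)
open import Data.Fin.Subset.Properties
  using (_∈?_; ∣p∣≤n; ∣∁p∣≡n∸∣p∣; x∉p⇒x∈∁p; x∈⁅y⁆⇒x≡y; ∣⁅x⁆∣≡1; ∣⊤∣≡n; p⊆q⇒∣p∣≤∣q∣)
open import Data.Vec using (_∷_; tabulate; here; there)
open import Data.Vec.Properties using (lookup⇒[]=; []=⇒lookup; lookup∘tabulate)
open import Data.Bool using (true; false; _∧_; _∨_)
open import Data.Maybe using (Maybe; just; nothing; maybe′)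
open import Data.Maybe.Properties using (just-injective) renaming (≡-dec to ≡-decᴹ)
open import Data.Product using (Σ; Σ-syntax; ∃; _×_; _,_; proj₁; proj₂; map₂)
open import Data.Sum using (_⊎_; inj₁; inj₂; [_,_]′; swap)
open import Data.Sum.Properties using (inj₁-injective; inj₂-injective)
open import Data.Sum.Function.Propositional using (_⊎-↔_)
open import Data.Empty using (⊥-elim)
open import Function using (_∘_; id; _↔_; Inverse; case_of_)
open import Function.Construct.Composition using (_↔-∘_)
open import Function.Construct.Identity using (↔-id)
open import Function.Definitions using (Surjective)
open import Relation.Nullary using (¬_; Dec; yes; no; does)
open import Relation.Nullary.Decidable using (map′; decidable-stable; ¬¬-excluded-middle; _⊎-dec_; dec-true)
open import Relation.Unary using (Pred; Decidable)
open import Relation.Binary.PropositionalEquality using (_≡_; _≢_; refl; sym; trans; cong; subst)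
open import Relation.Binary.Definitions using (tri<; tri≈; tri>)

private
  variable
    m n h : ℕ

byExcludedMiddle : ∀ {a b} {A : Set a} {B : Set b} → Dec B → (Dec A → B) → B
byExcludedMiddle b? f = decidable-stable b? λ ¬b → ¬¬-excluded-middle (¬b ∘ f)

∧-true⁻ : ∀ {a b} → a ∧ b ≡ true → a ≡ true × b ≡ true
∧-true⁻ {true} {true} _ = refl , refl

∨-true⁻ : ∀ {a b} → a ∨ b ≡ true → a ≡ true ⊎ b ≡ true
∨-true⁻ {true} _ = inj₁ refl
∨-true⁻ {false} e = inj₂ e

==⇒≡ : {i j : Fin n} → i == j ≡ true → i ≡ j
==⇒≡ {i = i} {j} e with i ≟ j
... | yes i≡j = i≡j

==-refl : (i : Fin n) → i == i ≡ true
==-refl i with i ≟ i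
... | yes _ = refl
... | no i≢i = ⊥-elim (i≢i refl)

index : (p : Subset m) {i : Fin m} → i ∈ p → Fin ∣ p ∣
index (true ∷ p) here = zero
index (true ∷ p) (there i∈p) = suc (index p i∈p)
index (false ∷ p) (there i∈p) = index p i∈p

enum : (p : Subset m) → Fin ∣ p ∣ → Fin m
enum (true ∷ p) zero = zero
enum (true ∷ p) (suc k) = suc (enum p k)
enum (false ∷ p) k = suc (enum p k)

enum-∈ : (p : Subset m) (k : Fin ∣ p ∣) → enum p k ∈ p
enum-∈ (true ∷ p) zero = here
enum-∈ (true ∷ p) (suc k) = there (enum-∈ p k)
enum-∈ (false ∷ p) k = there (enum-∈ p k)

enum-index : (p : Subset m) {i : Fin m} (i∈p : i ∈ p) → enum p (index p i∈p) ≡ i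
enum-index (true ∷ p) here = refl
enum-index (true ∷ p) (there i∈p) = cong suc (enum-index p i∈p)
enum-index (false ∷ p) (there i∈p) = cong suc (enum-index p i∈p)

index-enum : (p : Subset m) (k : Fin ∣ p ∣) (k∈p : enum p k ∈ p) → index p k∈p ≡ k
index-enum (true ∷ p) zero here = refl
index-enum (true ∷ p) (suc k) (there k∈p) = cong suc (index-enum p k k∈p)
index-enum (false ∷ p) k (there k∈p) = index-enum p k k∈p

index-injective : (p : Subset m) {i j : Fin m} (i∈p : i ∈ p) (j∈p : j ∈ p) →
                  index p i∈p ≡ index p j∈p → i ≡ j
index-injective p i∈p j∈p eq =
  trans (sym (enum-index p i∈p)) (trans (cong (enum p) eq) (enum-index p j∈p))

enum-injective : (p : Subset m) {k l : Fin ∣ p ∣} → enum p k ≡ enum p l → k ≡ l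
enum-injective (true ∷ p) {zero} {zero} _ = refl
enum-injective (true ∷ p) {suc k} {suc l} eq = cong suc (enum-injective p (suc-injective eq))
enum-injective (false ∷ p) eq = enum-injective p (suc-injective eq)

injection⇒∣p∣≤∣q∣ : (p : Subset m) (q : Subset n) (φ : ∀ {i} → i ∈ p → Fin n) →
                    (∀ {i} (i∈p : i ∈ p) → φ i∈p ∈ q) →
                    (∀ {i j} (i∈p : i ∈ p) (j∈p : j ∈ p) → φ i∈p ≡ φ j∈p → i ≡ j) →
                    ∣ p ∣ ≤ ∣ q ∣
injection⇒∣p∣≤∣q∣ p q φ φ∈q φ-injective = injective⇒≤ {f = f} f-injective
  where
  f : Fin ∣ p ∣ → Fin ∣ q ∣
  f k = index q (φ∈q (enum-∈ p k))
  f-injective : ∀ {k l} → f k ≡ f l → k ≡ l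
  f-injective eq = enum-injective p (φ-injective _ _ (index-injective q _ _ eq))

subsetOf : ∀ {ℓ} {P : Pred (Fin m) ℓ} → Decidable P → Subset m
subsetOf P? = tabulate (does ∘ P?)

module _ {ℓ} {P : Pred (Fin m) ℓ} (P? : Decidable P) where

  ∈-subsetOf⁺ : ∀ {i} → P i → i ∈ subsetOf P?
  ∈-subsetOf⁺ {i} Pi = lookup⇒[]= i _ (trans (lookup∘tabulate (does ∘ P?) i) (dec-true (P? i) Pi))

  ∈-subsetOf⁻ : ∀ {i} → i ∈ subsetOf P? → P i
  ∈-subsetOf⁻ {i} i∈ with P? i | trans (sym (lookup∘tabulate (does ∘ P?) i)) ([]=⇒lookup i∈)
  ... | yes Pi | _ = Pi

partialImage : (Fin m → Maybe (Fin n)) → Subset n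
partialImage f = subsetOf λ j → any? λ i → ≡-decᴹ _≟_ (f i) (just j)

∈-partialImage⁺ : (f : Fin m → Maybe (Fin n)) {i : Fin m} {j : Fin n} → f i ≡ just j → j ∈ partialImage f
∈-partialImage⁺ f {i} fi≡j = ∈-subsetOf⁺ (λ j → any? λ i → ≡-decᴹ _≟_ (f i) (just j)) (i , fi≡j)

∈-partialImage⁻ : (f : Fin m → Maybe (Fin n)) {j : Fin n} → j ∈ partialImage f → ∃ λ i → f i ≡ just j
∈-partialImage⁻ f = ∈-subsetOf⁻ λ j → any? λ i → ≡-decᴹ _≟_ (f i) (just j)

image : (Fin m → Fin n) → Subset n
image f = partialImage (just ∘ f)

∈-image⁺ : (f : Fin m → Fin n) (i : Fin m) → f i ∈ image f
∈-image⁺ f i = ∈-partialImage⁺ (just ∘ f) refl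

∈-image⁻ : (f : Fin m → Fin n) {j : Fin n} → j ∈ image f → ∃ λ i → f i ≡ j
∈-image⁻ f = map₂ just-injective ∘ ∈-partialImage⁻ (just ∘ f)

∣partialImage∣+∣p∣<m : (f : Fin m → Maybe (Fin n)) (p : Subset m) {i₀ : Fin m} →
                       i₀ ∉ p → f i₀ ≡ nothing → (∀ {i} → i ∈ p → f i ≡ nothing) →
                       ∣ partialImage f ∣ + ∣ p ∣ < m
∣partialImage∣+∣p∣<m {m} {n} f p {i₀} i₀∉p fi₀≡nothing f-p = begin
  suc ∣ partialImage f ∣ + ∣ p ∣ ≤⟨ +-monoˡ-≤ ∣ p ∣ (subst (_ ≤_) (∣∁p∣≡n∸∣p∣ p) into-∁p) ⟩
  m ∸ ∣ p ∣ + ∣ p ∣              ≡⟨ m∸n+n≡m (∣p∣≤n p) ⟩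
  m                              ∎
  where
  open ≤-Reasoning
  preimage : ∀ {j} → j ∈ partialImage f → ∃ λ i → f i ≡ just j
  preimage = ∈-partialImage⁻ f
  φ : ∀ {j} → j ∈ true ∷ partialImage f → Fin m
  φ here = i₀
  φ (there j∈) = proj₁ (preimage j∈)
  decode : Fin m → Fin (suc n)
  decode = maybe′ suc zero ∘ f
  decode-φ : ∀ {j} (j∈ : j ∈ true ∷ partialImage f) → decode (φ j∈) ≡ j
  decode-φ here = cong (maybe′ suc zero) fi₀≡nothing
  decode-φ (there j∈) = cong (maybe′ suc zero) (proj₂ (preimage j∈))
  φ∈∁p : ∀ {j} (j∈ : j ∈ true ∷ partialImage f) → φ j∈ ∈ ∁ p
  φ∈∁p here = x∉p⇒x∈∁p i₀∉p
  φ∈∁p (there j∈) = x∉p⇒x∈∁p λ i∈p → case trans (sym (proj₂ (preimage j∈))) (f-p i∈p) of λ ()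
  into-∁p : ∣ true ∷ partialImage f ∣ ≤ ∣ ∁ p ∣
  into-∁p = injection⇒∣p∣≤∣q∣ (true ∷ partialImage f) (∁ p) φ φ∈∁p
    λ i∈ j∈ eq → trans (sym (decode-φ i∈)) (trans (cong decode eq) (decode-φ j∈))

ColorCountsAtLeast : FinGraph h → ℕ → Set
ColorCountsAtLeast {h} H k = ∀ k' (c : Fin h → Fin k') → Proper H c → k ≤ k'

minimal-coloring-surjective : ∀ {k} (H : FinGraph h) → ColorCountsAtLeast H k →
                              (c : Fin h → Fin k) → Proper H c → ∀ j → ∃ λ x → c x ≡ j
minimal-coloring-surjective {k = zero} H minimal c c-proper ()
minimal-coloring-surjective {h} {k = suc k} H minimal c c-proper j with any? (λ x → c x ≟ j)
... | yes found = found
... | no missed = ⊥-elim (1+n≰n (minimal k c' c'-proper))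
  where
  j≢c : ∀ x → j ≢ c x
  j≢c x j≡cx = missed (x , sym j≡cx)
  c' : Fin h → Fin k
  c' x = punchOut (j≢c x)
  c'-proper : Proper H c'
  c'-proper x y x~y eq = c-proper x y x~y (punchOut-injective (j≢c x) (j≢c y) eq)

χ≤∣image∣ : ∀ {k} (H : FinGraph h) → ColorCountsAtLeast H k →
            (c : Fin h → Fin m) → Proper H c → k ≤ ∣ image c ∣
χ≤∣image∣ {h} H minimal c c-proper =
  minimal _ c' λ x y x~y eq → c-proper x y x~y (index-injective (image c) _ _ eq)
  where
  c' : Fin h → Fin ∣ image c ∣
  c' x = index (image c) (∈-image⁺ c x)

SolitaryOrDominating : ∀ {V : Set} {k} (X : Graph V) → (V → Fin k) → V → Set
SolitaryOrDominating {V} {k} X c u =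
  (∀ (v : V) → c v ≡ c u → v ≡ u) ⊎ Σ[ i ∈ Fin k ] (∀ (v : V) → c v ≡ i → Adjacent X u v)

module _ (G : FinGraph n) where

  Endpoint : Fin n → Edge G → Set
  Endpoint u E = endpoint {G = G} u E ≡ true

  adjacent⇒≢ : ∀ {u v} → Adjacent G u v → u ≢ v
  adjacent⇒≢ {u} u~v refl with trans (sym u~v) (adjIrr G u)
  ... | ()

  endpoint⁻ : ∀ {u} (E : Edge G) → Endpoint u E → u ≡ proj₁ (proj₁ E) ⊎ u ≡ proj₂ (proj₁ E)
  endpoint⁻ {u} ((a , a') , _) u∈E with ∨-true⁻ {u == a} u∈E
  ... | inj₁ u==a = inj₁ (==⇒≡ u==a)
  ... | inj₂ u==a' = inj₂ (==⇒≡ u==a')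

  endpoint-fst : (E : Edge G) → Endpoint (proj₁ (proj₁ E)) E
  endpoint-fst ((a , a') , _) rewrite ==-refl a = refl

  endpoint-snd : (E : Edge G) → Endpoint (proj₂ (proj₁ E)) E
  endpoint-snd ((a , a') , _) rewrite ==-refl a' with a' == a
  ... | true = refl
  ... | false = refl

  endpoint-cong : ∀ {u} (E E' : Edge G) → proj₁ E ≡ proj₁ E' → Endpoint u E → Endpoint u E'
  endpoint-cong ((a , a') , _) ((.a , .a') , _) refl u∈E = u∈E

  sameEdge⇒≡ : (E E' : Edge G) → sameEdge {G = G} E E' ≡ true → proj₁ E ≡ proj₁ E'
  sameEdge⇒≡ ((a , a') , _) ((b , b') , _) same with ∧-true⁻ {a == b} same
  ... | a==b , a'==b' with ==⇒≡ a==b | ==⇒≡ a'==b'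
  ...   | refl | refl = refl

  sameEdge-refl : (E : Edge G) → sameEdge {G = G} E E ≡ true
  sameEdge-refl ((a , a') , _) rewrite ==-refl a | ==-refl a' = refl

  endpoints-adjacent : ∀ {t u} (E : Edge G) → Endpoint t E → Endpoint u E → u ≡ t ⊎ Adjacent G t u
  endpoints-adjacent {t} {u} E@((a , a') , _ , a~a') t∈E u∈E with endpoint⁻ {t} E t∈E | endpoint⁻ {u} E u∈E
  ... | inj₁ refl | inj₁ refl = inj₁ refl
  ... | inj₂ refl | inj₂ refl = inj₁ refl
  ... | inj₁ refl | inj₂ refl = inj₂ a~a'
  ... | inj₂ refl | inj₁ refl = inj₂ (trans (adjSym G a' a) a~a')

  edgeBetween : ∀ u v → Adjacent G u v → Σ (Edge G) λ E → proj₁ E ≡ (u , v) ⊎ proj₁ E ≡ (v , u)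
  edgeBetween u v u~v with <-cmp u v
  ... | tri< u<v _ _ = ((u , v) , u<v , u~v) , inj₁ refl
  ... | tri≈ _ u≡v _ = ⊥-elim (adjacent⇒≢ u~v u≡v)
  ... | tri> _ _ v<u = ((v , u) , v<u , trans (adjSym G v u) u~v) , inj₂ refl

  edgeBetween-endpoints : ∀ u v (u~v : Adjacent G u v) →
                          Endpoint u (proj₁ (edgeBetween u v u~v)) × Endpoint v (proj₁ (edgeBetween u v u~v))
  edgeBetween-endpoints u v u~v with edgeBetween u v u~v
  ... | E , inj₁ refl = endpoint-fst E , endpoint-snd E
  ... | E , inj₂ refl = endpoint-snd E , endpoint-fst E

  edgewise⇒VertexCover : (S : Subset n) → (∀ (E : Edge G) → proj₁ (proj₁ E) ∈ S ⊎ proj₂ (proj₁ E) ∈ S) →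
                         VertexCover G S
  edgewise⇒VertexCover S covers u v u~v with edgeBetween u v u~v
  ... | E , inj₁ refl = covers E
  ... | E , inj₂ refl with covers E
  ...   | inj₁ v∈S = inj₂ v∈S
  ...   | inj₂ u∈S = inj₁ u∈S

  ∁⁅v⁆-vertexCover : ∀ v → VertexCover G (∁ ⁅ v ⁆)
  ∁⁅v⁆-vertexCover v u w u~w with u ≟ v
  ... | yes refl = inj₂ (x∉p⇒x∈∁p λ w∈⁅u⁆ → adjacent⇒≢ u~w (sym (x∈⁅y⁆⇒x≡y u w∈⁅u⁆)))
  ... | no u≢v = inj₁ (x∉p⇒x∈∁p λ u∈⁅v⁆ → u≢v (x∈⁅y⁆⇒x≡y v u∈⁅v⁆))

CoverSizesAtLeast : FinGraph n → ℕ → Set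
CoverSizesAtLeast {n} G b = ∀ (S : Subset n) → VertexCover G S → b ≤ ∣ S ∣

minimumCover-misses-a-vertex : (G : FinGraph (suc n)) (S : Subset (suc n)) →
                               CoverSizesAtLeast G ∣ S ∣ → ∃ λ u → u ∉ S
minimumCover-misses-a-vertex {n} G S minimum = ¬∀⟶∃¬ (suc n) (_∈ S) (_∈? S) λ all∈S → 1+n≰n (begin
  suc n         ≡⟨ sym (∣⊤∣≡n (suc n)) ⟩
  ∣ ⊤ {suc n} ∣ ≤⟨ p⊆q⇒∣p∣≤∣q∣ {p = ⊤ {suc n}} (λ {u} _ → all∈S u) ⟩
  ∣ S ∣         ≤⟨ minimum _ (∁⁅v⁆-vertexCover G v) ⟩
  ∣ ∁ ⁅ v ⁆ ∣   ≡⟨ trans (∣∁p∣≡n∸∣p∣ ⁅ v ⁆) (cong (suc n ∸_) (∣⁅x⁆∣≡1 v)) ⟩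
  suc n ∸ 1     ∎)
  where
  open ≤-Reasoning
  v : Fin (suc n)
  v = zero

-- Upper bound

colorCode : ∀ {b k} → Fin (b + k + 1) ↔ ((Fin b ⊎ Fin k) ⊎ Fin 1)
colorCode {b} {k} = (+↔⊎ {b} {k} ⊎-↔ ↔-id (Fin 1)) ↔-∘ +↔⊎ {b + k} {1}

module CoverColoring (G : FinGraph n) (H : FinGraph h) (noIsolated : NoIsolatedVertices G)
  (S : Subset n) (S-cover : VertexCover G S) (u₀ : Fin n) (u₀∉S : u₀ ∉ S) (E₀ : Edge G)
  {k : ℕ} (cH : Fin h → Fin k) (cH-proper : Proper H cH) (cH-surjective : ∀ j → ∃ λ x → cH x ≡ j) where

  -- u₀ and E₀ serve only to show that the last color and the colors of H are used.

  open Inverse (colorCode {∣ S ∣} {k}) using (to; from; strictlyInverseˡ; strictlyInverseʳ)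

  paint : CoronaV G h → (Fin ∣ S ∣ ⊎ Fin k) ⊎ Fin 1
  paint (inj₁ u) with u ∈? S
  ... | yes u∈S = inj₁ (inj₁ (index S u∈S))
  ... | no _ = inj₂ zero
  paint (inj₂ (_ , x)) = inj₁ (inj₂ (cH x))

  coloring : CoronaV G h → Fin (∣ S ∣ + k + 1)
  coloring = from ∘ paint

  coloring⇒paint : ∀ {z z'} → coloring z ≡ coloring z' → paint z ≡ paint z'
  coloring⇒paint {z} {z'} eq =
    trans (sym (strictlyInverseˡ (paint z))) (trans (cong to eq) (strictlyInverseˡ (paint z')))

  paint-proper : ∀ z z' → Adjacent (G ⋄ H) z z' → paint z ≢ paint z'
  paint-proper (inj₁ u) (inj₁ v) u~v with u ∈? S | v ∈? S
  ... | yes u∈S | yes v∈S = adjacent⇒≢ G u~v ∘ index-injective S u∈S v∈S ∘ inj₁-injective ∘ inj₁-injective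
  ... | yes _ | no _ = λ ()
  ... | no _ | yes _ = λ ()
  ... | no u∉S | no v∉S = λ _ → [ u∉S , v∉S ]′ (S-cover u v u~v)
  paint-proper (inj₁ u) (inj₂ _) _ with u ∈? S
  ... | yes _ = λ ()
  ... | no _ = λ ()
  paint-proper (inj₂ _) (inj₁ u) _ with u ∈? S
  ... | yes _ = λ ()
  ... | no _ = λ ()
  paint-proper (inj₂ (E , x)) (inj₂ (E' , y)) x~y =
    cH-proper x y (proj₂ (∧-true⁻ {sameEdge {G = G} E E'} x~y)) ∘ inj₂-injective ∘ inj₁-injective

  paint-solitary : ∀ {u} → u ∈ S → ∀ z → paint z ≡ paint (inj₁ u) → z ≡ inj₁ u
  paint-solitary {u} u∈S (inj₁ v) eq with u ∈? S | v ∈? S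
  ... | yes u∈S' | yes v∈S = cong inj₁ (index-injective S v∈S u∈S' (inj₁-injective (inj₁-injective eq)))
  ... | yes _ | no _ = case eq of λ ()
  ... | no u∉S | _ = ⊥-elim (u∉S u∈S)
  paint-solitary {u} u∈S (inj₂ _) eq with u ∈? S
  ... | yes _ = case eq of λ ()
  ... | no u∉S = ⊥-elim (u∉S u∈S)

  paint-surjective : ∀ c → ∃ λ z → paint z ≡ c
  paint-surjective (inj₁ (inj₁ i)) = inj₁ (enum S i) , paint-enum
    where
    paint-enum : paint (inj₁ (enum S i)) ≡ inj₁ (inj₁ i)
    paint-enum with enum S i ∈? S
    ... | yes i∈S = cong (inj₁ ∘ inj₁) (index-enum S i i∈S)
    ... | no i∉S = ⊥-elim (i∉S (enum-∈ S i))
  paint-surjective (inj₁ (inj₂ j)) with cH-surjective j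
  ... | x , cHx≡j = inj₂ (E₀ , x) , cong (inj₁ ∘ inj₂) cHx≡j
  paint-surjective (inj₂ zero) = inj₁ u₀ , paint-u₀
    where
    paint-u₀ : paint (inj₁ u₀) ≡ inj₂ zero
    paint-u₀ with u₀ ∈? S
    ... | yes u₀∈S = ⊥-elim (u₀∉S u₀∈S)
    ... | no _ = refl

  coloring-solitary : ∀ {u} → u ∈ S → ∀ z → coloring z ≡ coloring (inj₁ u) → z ≡ inj₁ u
  coloring-solitary u∈S z = paint-solitary u∈S z ∘ coloring⇒paint {z}

  dominates-via-cover : ∀ y {w} → w ∈ S → Adjacent (G ⋄ H) y (inj₁ w) →
                        Σ[ i ∈ Fin (∣ S ∣ + k + 1) ] (∀ z → coloring z ≡ i → Adjacent (G ⋄ H) y z)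
  dominates-via-cover y {w} w∈S y~w =
    coloring (inj₁ w) , λ z eq → subst (Adjacent (G ⋄ H) y) (sym (coloring-solitary w∈S z eq)) y~w

  dominating-vertex : ∀ u → Dec (u ∈ S) → SolitaryOrDominating (G ⋄ H) coloring (inj₁ u)
  dominating-vertex u (yes u∈S) = inj₁ (coloring-solitary u∈S)
  dominating-vertex u (no u∉S) with noIsolated u
  ... | w , u~w = inj₂ (dominates-via-cover (inj₁ u) ([ ⊥-elim ∘ u∉S , id ]′ (S-cover u w u~w)) u~w)

  dominating : ∀ y → SolitaryOrDominating (G ⋄ H) coloring y
  dominating (inj₁ u) = dominating-vertex u (u ∈? S)
  dominating (inj₂ (E , x)) with S-cover _ _ (proj₂ (proj₂ E))
  ... | inj₁ a∈S = inj₂ (dominates-via-cover (inj₂ (E , x)) a∈S (endpoint-fst G E))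
  ... | inj₂ a'∈S = inj₂ (dominates-via-cover (inj₂ (E , x)) a'∈S (endpoint-snd G E))

  coloring-surjective : Surjective _≡_ _≡_ coloring
  coloring-surjective i with paint-surjective (to i)
  ... | z , paint-z = z , λ { refl → trans (cong from paint-z) (strictlyInverseʳ i) }

  dominatorColoring : DominatorColoring (G ⋄ H) (∣ S ∣ + k + 1) coloring
  dominatorColoring =
    (λ z z' z~z' → paint-proper z z' z~z' ∘ coloring⇒paint {z} {z'}) , coloring-surjective , dominating

-- Lower bound

module DominatorColoringBound (G : FinGraph n) (H : FinGraph h) (x₀ : Fin h)
  {k' : ℕ} (c : CoronaV G h → Fin k') (c-proper : Proper (G ⋄ H) c) (c-surjective : Surjective _≡_ _≡_ c)
  (c-dominating : ∀ y → SolitaryOrDominating (G ⋄ H) c y)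
  where

  witness : Fin k' → CoronaV G h
  witness γ = proj₁ (c-surjective γ)

  witness-color : ∀ γ → c (witness γ) ≡ γ
  witness-color γ = proj₂ (c-surjective γ) refl

  Solitary : Fin n → Set
  Solitary u = ∀ z → c z ≡ c (inj₁ u) → z ≡ inj₁ u

  -- Shared u is not decidable here, as the vertices of G ⋄ H are not enumerated; case splits on it
  -- are made inside decidable goals via byExcludedMiddle.
  Shared : Fin n → Set
  Shared u = ∃ λ z → c z ≡ c (inj₁ u) × z ≢ inj₁ u

  Shared⇒¬Solitary : ∀ {u} → Shared u → ¬ Solitary u
  Shared⇒¬Solitary (z , cz≡cu , z≢u) solitary = z≢u (solitary z cz≡cu)

  ¬Shared⇒Solitary : ∀ {u} → ¬ Shared u → Solitary u
  ¬Shared⇒Solitary {u} ¬shared z cz≡cu = decidable-stable (z ≟inj₁ u) λ z≢u → ¬shared (z , cz≡cu , z≢u)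
    where
    _≟inj₁_ : (z : CoronaV G h) (u : Fin n) → Dec (z ≡ inj₁ u)
    inj₁ v ≟inj₁ u = map′ (cong inj₁) inj₁-injective (v ≟ u)
    inj₂ _ ≟inj₁ u = no λ ()

  copyOf : CoronaV G h → Maybe (Fin n × Fin n)
  copyOf (inj₁ _) = nothing
  copyOf (inj₂ (E , _)) = just (proj₁ E)

  owner : CoronaV G h → Fin n
  owner (inj₁ u) = u
  owner (inj₂ (E , _)) = proj₁ (proj₁ E)

  owner-copy : ∀ z {a a'} → copyOf z ≡ just (a , a') → owner z ≡ a
  owner-copy (inj₂ (((b , b') , _) , _)) refl = refl

  dominated-endpoint-solitary : ∀ E x i → (∀ z → c z ≡ i → Adjacent (G ⋄ H) (inj₂ (E , x)) z) →
                                ∀ {t} → Endpoint G t E → c (inj₁ t) ≡ i → Solitary t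
  dominated-endpoint-solitary E x i dominated {t} t∈E ct≡i (inj₁ u) cu≡ct
    with endpoints-adjacent G E t∈E (dominated (inj₁ u) (trans cu≡ct ct≡i))
  ... | inj₁ u≡t = cong inj₁ u≡t
  ... | inj₂ t~u = ⊥-elim (c-proper (inj₁ t) (inj₁ u) t~u (sym cu≡ct))
  dominated-endpoint-solitary E x i dominated {t} t∈E ct≡i (inj₂ (E' , x')) cz≡ct =
    ⊥-elim (c-proper (inj₁ t) (inj₂ (E' , x')) t∈E' (sym cz≡ct))
    where
    same : sameEdge {G = G} E E' ≡ true
    same = proj₁ (∧-true⁻ (dominated (inj₂ (E' , x')) (trans cz≡ct ct≡i)))
    t∈E' : Endpoint G t E'
    t∈E' = endpoint-cong G {t} E E' (sameEdge⇒≡ G E E' same) t∈E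

  privateColor : (E : Edge G) → (∀ {t} → Endpoint G t E → Shared t) →
                 Σ[ γ ∈ Fin k' ] (∀ z → c z ≡ γ → copyOf z ≡ just (proj₁ E))
  privateColor E shared with c-dominating (inj₂ (E , x₀))
  ... | inj₁ solitary = c (inj₂ (E , x₀)) , λ z cz≡ → cong copyOf (solitary z cz≡)
  ... | inj₂ (i , dominated) = i , inCopy
    where
    inCopy : ∀ z → c z ≡ i → copyOf z ≡ just (proj₁ E)
    inCopy (inj₁ u) cu≡i =
      ⊥-elim (Shared⇒¬Solitary (shared u∈E) (dominated-endpoint-solitary E x₀ i dominated u∈E cu≡i))
      where
      u∈E : Endpoint G u E
      u∈E = dominated (inj₁ u) cu≡i
    inCopy (inj₂ (E' , x')) cz≡i =
      cong just (sym (sameEdge⇒≡ G E E' (proj₁ (∧-true⁻ (dominated (inj₂ (E' , x')) cz≡i)))))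

  module CoverFromColors (v w : Fin n) (v~w : Adjacent G v w) (v-shared-or-all-solitary : Shared v ⊎ (∀ u → Solitary u))
    where

    E₀ : Edge G
    E₀ = proj₁ (edgeBetween G v w v~w)

    v∈E₀ : Endpoint G v E₀
    v∈E₀ = proj₁ (edgeBetween-endpoints G v w v~w)

    w∈E₀ : Endpoint G w E₀
    w∈E₀ = proj₂ (edgeBetween-endpoints G v w v~w)

    colorOnCopy₀ : Fin h → Fin k'
    colorOnCopy₀ x = c (inj₂ (E₀ , x))

    Q : Subset k'
    Q = image colorOnCopy₀

    -- c(w) names w itself rather than the owner of some vertex of that color: the edge vw cannot be
    -- covered through a private color, as that would lie in Q.
    pick : Fin k' → Maybe (Fin n)
    pick γ with γ ∈? Q | γ ≟ c (inj₁ v) | γ ≟ c (inj₁ w)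
    ... | yes _ | _     | _     = nothing
    ... | no _  | yes _ | _     = nothing
    ... | no _  | no _  | yes _ = just w
    ... | no _  | no _  | no _  = just (owner (witness γ))

    T : Subset n
    T = partialImage pick

    endpoint-color∉Q : ∀ {t} → Endpoint G t E₀ → c (inj₁ t) ∉ Q
    endpoint-color∉Q {t} t∈E₀ ct∈Q with ∈-image⁻ colorOnCopy₀ ct∈Q
    ... | x , eq = c-proper (inj₁ t) (inj₂ (E₀ , x)) t∈E₀ (sym eq)

    pick-Q : ∀ {γ} → γ ∈ Q → pick γ ≡ nothing
    pick-Q {γ} γ∈Q with γ ∈? Q
    ... | yes _ = refl
    ... | no γ∉Q = ⊥-elim (γ∉Q γ∈Q)

    pick-v : pick (c (inj₁ v)) ≡ nothing
    pick-v with c (inj₁ v) ∈? Q | c (inj₁ v) ≟ c (inj₁ v)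
    ... | yes _ | _ = refl
    ... | no _ | yes _ = refl
    ... | no _ | no cv≢cv = ⊥-elim (cv≢cv refl)

    w∈T : w ∈ T
    w∈T = ∈-partialImage⁺ pick pick-w
      where
      pick-w : pick (c (inj₁ w)) ≡ just w
      pick-w with c (inj₁ w) ∈? Q | c (inj₁ w) ≟ c (inj₁ v) | c (inj₁ w) ≟ c (inj₁ w)
      ... | yes cw∈Q | _ | _ = ⊥-elim (endpoint-color∉Q w∈E₀ cw∈Q)
      ... | no _ | yes cw≡cv | _ = ⊥-elim (c-proper (inj₁ v) (inj₁ w) v~w (sym cw≡cv))
      ... | no _ | no _ | yes _ = refl
      ... | no _ | no _ | no cw≢cw = ⊥-elim (cw≢cw refl)

    owner∈T : ∀ {γ} → γ ∉ Q → γ ≢ c (inj₁ v) → γ ≢ c (inj₁ w) → owner (witness γ) ∈ T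
    owner∈T {γ} γ∉Q γ≢cv γ≢cw = ∈-partialImage⁺ pick pick-γ
      where
      pick-γ : pick γ ≡ just (owner (witness γ))
      pick-γ with γ ∈? Q | γ ≟ c (inj₁ v) | γ ≟ c (inj₁ w)
      ... | yes γ∈Q | _ | _ = ⊥-elim (γ∉Q γ∈Q)
      ... | no _ | yes γ≡cv | _ = ⊥-elim (γ≢cv γ≡cv)
      ... | no _ | no _ | yes γ≡cw = ⊥-elim (γ≢cw γ≡cw)
      ... | no _ | no _ | no _ = refl

    solitary∈T : ∀ {a} → Solitary a → a ≢ v → a ∈ T
    solitary∈T {a} solitary a≢v with c (inj₁ a) ≟ c (inj₁ w)
    ... | yes ca≡cw = subst (_∈ T) (inj₁-injective (solitary (inj₁ w) (sym ca≡cw))) w∈T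
    ... | no ca≢cw =
      subst (_∈ T) (cong owner (solitary _ (witness-color _))) (owner∈T ca∉Q ca≢cv ca≢cw)
      where
      ca∉Q : c (inj₁ a) ∉ Q
      ca∉Q ca∈Q with ∈-image⁻ colorOnCopy₀ ca∈Q
      ... | x , eq = case solitary (inj₂ (E₀ , x)) eq of λ ()
      ca≢cv : c (inj₁ a) ≢ c (inj₁ v)
      ca≢cv eq = a≢v (sym (inj₁-injective (solitary (inj₁ v) (sym eq))))

    privateOwner∈T : (E : Edge G) → (∀ {t} → Endpoint G t E → Shared t) → ¬ Endpoint G w E →
                     proj₁ (proj₁ E) ∈ T
    privateOwner∈T E shared w∉E with privateColor E shared
    ... | γ , inCopy =
      subst (_∈ T) (owner-copy (witness γ) (inCopy _ (witness-color γ))) (owner∈T γ∉Q γ≢cv γ≢cw)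
      where
      γ∉Q : γ ∉ Q
      γ∉Q γ∈Q with ∈-image⁻ colorOnCopy₀ γ∈Q
      ... | x , eq = w∉E (endpoint-cong G {w} E₀ E (just-injective (inCopy _ eq)) w∈E₀)
      γ≢cv : γ ≢ c (inj₁ v)
      γ≢cv eq = case inCopy (inj₁ v) (sym eq) of λ ()
      γ≢cw : γ ≢ c (inj₁ w)
      γ≢cw eq = case inCopy (inj₁ w) (sym eq) of λ ()

    -- A solitary vertex other than v is named by its own color; if v is solitary, then by the choice
    -- of v so is every vertex.
    solitaryEndpoint-covers : ∀ {a a'} → Adjacent G a a' → Solitary a → a ∈ T ⊎ a' ∈ T
    solitaryEndpoint-covers {a} {a'} a~a' solitary with a ≟ v
    ... | no a≢v = inj₁ (solitary∈T solitary a≢v)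
    ... | yes refl = [ (λ v-shared → ⊥-elim (Shared⇒¬Solitary v-shared solitary))
                     , (λ all-solitary → inj₂ (solitary∈T (all-solitary a') (adjacent⇒≢ G a~a' ∘ sym))) ]′
                     v-shared-or-all-solitary

    T-covers : (E : Edge G) → proj₁ (proj₁ E) ∈ T ⊎ proj₂ (proj₁ E) ∈ T
    T-covers E@((a , a') , _ , a~a') with a ≟ w | a' ≟ w
    ... | yes refl | _ = inj₁ w∈T
    ... | _ | yes refl = inj₂ w∈T
    ... | no a≢w | no a'≢w =
      byExcludedMiddle (a ∈? T ⊎-dec a' ∈? T) λ a? →
      byExcludedMiddle (a ∈? T ⊎-dec a' ∈? T) λ a'? → cover a? a'?
      where
      cover : Dec (Shared a) → Dec (Shared a') → a ∈ T ⊎ a' ∈ T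
      cover (no ¬a-shared) _ = solitaryEndpoint-covers a~a' (¬Shared⇒Solitary ¬a-shared)
      cover _ (no ¬a'-shared) =
        swap (solitaryEndpoint-covers (trans (adjSym G a' a) a~a') (¬Shared⇒Solitary ¬a'-shared))
      cover (yes a-shared) (yes a'-shared) = inj₁ (privateOwner∈T E shared w∉E)
        where
        shared : ∀ {t} → Endpoint G t E → Shared t
        shared {t} t∈E with endpoint⁻ G {t} E t∈E
        ... | inj₁ refl = a-shared
        ... | inj₂ refl = a'-shared
        w∉E : ¬ Endpoint G w E
        w∉E w∈E = [ a≢w ∘ sym , a'≢w ∘ sym ]′ (endpoint⁻ G {w} E w∈E)

    bound : ∀ {b k} → CoverSizesAtLeast G b → ColorCountsAtLeast H k → b + k + 1 ≤ k'
    bound {b} {k} cover-minimum coloring-minimum = begin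
      b + k + 1           ≡⟨ +-comm (b + k) 1 ⟩
      suc (b + k)         ≤⟨ s≤s (+-mono-≤ (cover-minimum T (edgewise⇒VertexCover G T T-covers))
                                           (χ≤∣image∣ H coloring-minimum colorOnCopy₀ copy₀-proper)) ⟩
      suc (∣ T ∣ + ∣ Q ∣) ≤⟨ ∣partialImage∣+∣p∣<m pick Q (endpoint-color∉Q v∈E₀) pick-v pick-Q ⟩
      k'                  ∎
      where
      open ≤-Reasoning
      copy₀-proper : Proper H colorOnCopy₀
      copy₀-proper x y x~y = c-proper (inj₂ (E₀ , x)) (inj₂ (E₀ , y))
        (subst (λ same → same ∧ adj H x y ≡ true) (sym (sameEdge-refl G E₀)) x~y)

  lowerBound : NoIsolatedVertices G → Fin n → ∀ {b k} → CoverSizesAtLeast G b → ColorCountsAtLeast H k →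
               b + k + 1 ≤ k'
  lowerBound noIsolated v₀ {b} {k} cover-minimum coloring-minimum =
    byExcludedMiddle {A = ∃ Shared} (b + k + 1 ≤? k') λ where
      (yes (v , v-shared)) → bound-at v (inj₁ v-shared)
      (no none-shared) → bound-at v₀ (inj₂ λ u → ¬Shared⇒Solitary λ u-shared → none-shared (u , u-shared))
    where
    bound-at : ∀ v → Shared v ⊎ (∀ u → Solitary u) → b + k + 1 ≤ k'
    bound-at v choice =
      CoverFromColors.bound v (proj₁ (noIsolated v)) (proj₂ (noIsolated v)) choice cover-minimum coloring-minimum

mainTheorem2 : {n h : ℕ} (G : FinGraph n) (H : FinGraph h) →
    1 ≤ n → NoIsolatedVertices G → 1 ≤ h →
    (b k : ℕ) → IsVertexCoverNumber G b → IsChromaticNumber H k →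
    IsDominatorChromaticNumber (G ⋄ H) (b + k + 1)
mainTheorem2 G H (s≤s _) noIsolated (s≤s _) b k
             (S , (S-cover , refl) , S-minimum) (cH , cH-proper , cH-minimum) =
  coloring , dominatorColoring ,
  λ k' c (c-proper , c-surjective , c-dominating) →
    DominatorColoringBound.lowerBound G H zero c c-proper c-surjective c-dominating
                                      noIsolated zero S-minimum cH-minimum
  where
  u₀∉S : ∃ λ u₀ → u₀ ∉ S
  u₀∉S = minimumCover-misses-a-vertex G S S-minimum
  E₀ : Edge G
  E₀ = proj₁ (edgeBetween G zero (proj₁ (noIsolated zero)) (proj₂ (noIsolated zero)))
  open CoverColoring G H noIsolated S S-cover (proj₁ u₀∉S) (proj₂ u₀∉S) E₀ cH cH-proper
    (minimal-coloring-surjective H cH-minimum cH cH-proper)
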